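{- Let $k\ge 3$ and let $n$ be an integer with \[ k<n<k+\left\lceil\frac{k}{2}\right\rceil\left(\left\lfloor\frac{k}{2}\right\rfloor+1\right). \] Then there exists a family $\mathcal{F}\subseteq \binom{[n]}{k}$ such that $\Phi_{n,k}(\mathcal{F})>1$.
   Context: $\binom{[n]}{k}$ denotes the family of all $k$-element subsets of $[n]$. For $A\in\mathcal{F}$, $i_{\mathcal{F}}(A):=\min_{B\in\mathcal{F}}|A\cap B|$, and $\Phi_{n,k}(\mathcal{F}):=\sum_{A\in \mathcal{F}}\binom{n-i_{\mathcal{F}}(A)}{k-i_{\mathcal{F}}(A)}^{ -1}$. -}

module Defs where

open import Data.Nat using (ℕ; zero; suc; _∸_; _⊓_)
open import Data.Nat.Combinatorics using (_C_)
open import Data.Integer using (+_)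
open import Data.Rational using (ℚ; 0ℚ; _+_; _/_)
open import Data.List using (List; []; _∷_; foldr; map)
open import Data.List.Relation.Unary.All using (All)
open import Data.List.Relation.Unary.Unique.Propositional using (Unique)
open import Data.Fin.Subset using (Subset; _∩_; ∣_∣)
open import Data.Product using (_×_)
open import Relation.Binary.PropositionalEquality using (_≡_)

IsFamily : (n k : ℕ) → List (Subset n) → Set
IsFamily n k F = Unique F × All (λ A → ∣ A ∣ ≡ k) F

minWith : ℕ → List ℕ → ℕ
minWith d []       = d
minWith d (x ∷ []) = x
minWith d (x ∷ y ∷ xs) = x ⊓ minWith d (y ∷ xs)

-- i_F(A) = min_{B ∈ F} |A ∩ B|  (only used for A ∈ F, so F is nonempty;
-- the default 0 for empty F is irrelevant)
iF : {n : ℕ} → List (Subset n) → Subset n → ℕ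
iF F A = minWith 0 (map (λ B → ∣ A ∩ B ∣) F)

-- 1/m as a rational; (the value at 0 is irrelevant: it is only applied to
-- binomials C(n-i, k-i) with i ≤ k ≤ n, which are positive)
recip : ℕ → ℚ
recip zero    = 0ℚ
recip (suc m) = (+ 1) / suc m

Φ : (n k : ℕ) → List (Subset n) → ℚ
Φ n k F = foldr _+_ 0ℚ (map (λ A → recip ((n ∸ iF F A) C (k ∸ iF F A))) F)

{-# OPTIONS --safe #-}
-- Split [n] into a block X of size y + 2 and its complement, of size N = n - y - 2, and let F
-- consist of the k-sets meeting X in exactly y + 1 points and the k-sets containing X.
-- Any two members of F share at least y points of X, and those containing X share at least
-- y + 1 points with every member, so with J = k - y - 2
--   Φ(F) ≥ (y + 2) C(N, J+1) / C(N+2, J+2) + C(N, J) / C(N+1, J+1).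
-- Absorption, (J+2) C(N+2, J+2) = (N+2) C(N+1, J+1), and Pascal's rule turn "> 1" into
-- N + 2 < (y + 2)(J + 2), which for y = ⌈k/2⌉ - 1 is the hypothesis on n.
module Submission where

open import Defs
open import Data.Fin.Subset using (Subset; _∩_; ∣_∣; inside; outside) renaming (⊥ to ∅)
open import Data.Fin.Subset.Properties using (∩-idem; ∣⊥∣≡0)
open import Data.Integer as ℤ using (+≤+; +<+)
import Data.Integer.Properties as ℤ
import Data.Integer.Tactic.RingSolver as ℤ
open import Data.List
  using (List; []; _∷_; _++_; map; foldr; length; cartesianProductWith)
open import Data.List.Properties using (length-++; length-map; map-++; foldr-++)
open import Data.List.Membership.Propositional using (_∈_)
open import Data.List.Membership.Propositional.Properties
  using (∈-map⁺; ∈-map⁻; ∈-++⁺ˡ; ∈-++⁺ʳ; ∈-++⁻; ∈-cartesianProductWith⁻)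
open import Data.List.Relation.Binary.Disjoint.Propositional using (Disjoint)
open import Data.List.Relation.Unary.All as All using (All; []; _∷_)
import Data.List.Relation.Unary.All.Properties as All
open import Data.List.Relation.Unary.AllPairs using ([]; _∷_)
open import Data.List.Relation.Unary.Any using (here; there)
open import Data.List.Relation.Unary.Unique.Propositional using (Unique)
import Data.List.Relation.Unary.Unique.Propositional.Properties as Unique
open import Data.Nat
  using (ℕ; zero; suc; _+_; _*_; _∸_; _≤_; _<_; z≤n; s≤s; ⌊_/2⌋; ⌈_/2⌉; >-nonZero)
open import Data.Nat.Combinatorics
  using (_C_; nC1≡n; nCn≡1; nCk≡nC[n∸k]) renaming (nCk+nC[k+1]≡[n+1]C[k+1] to pascal)
open import Data.Nat.Coprimality using (1-coprimeTo)
open import Data.Nat.Properties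
open import Data.Nat.Tactic.RingSolver using (solve-∀)
open import Data.Product using (Σ; _×_; _,_; proj₂; ∃₂)
open import Data.Rational as ℚ using (ℚ; 0ℚ; 1ℚ; mkℚ; toℚᵘ)
  renaming (_+_ to _+ℚ_; _≤_ to _≤ℚ_; _<_ to _<ℚ_)
import Data.Rational.Properties as ℚ
open import Algebra.Definitions.RawMonoid ℚ.+-0-rawMonoid using () renaming (_×_ to _·_)
import Data.Rational.Unnormalised as ℚᵘ
import Data.Rational.Unnormalised.Properties as ℚᵘ
open import Data.Sum using ([_,_]′)
open import Data.Vec using (_∷_) renaming (_++_ to _⧺_; [] to ⟨⟩)
open import Data.Vec.Properties using (∷-injectiveˡ; ∷-injectiveʳ; ++-injective; ++-injectiveˡ; zipWith-++)
open import Function using (case_of_)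
open import Relation.Binary.PropositionalEquality
  using (_≡_; _≢_; refl; sym; trans; cong; cong₂; subst; subst₂; module ≡-Reasoning)

private
  variable
    a b n k r s : ℕ

m+n+o∸n≡m+o : ∀ m n o → m + n + o ∸ n ≡ m + o
m+n+o∸n≡m+o m n o = trans (+-∸-comm o (m≤n+m n m)) (cong (_+ o) (m+n∸n≡m m n))

k≤n⇒nCk>0 : k ≤ n → 0 < n C k
k≤n⇒nCk>0 {zero}          _         = s≤s z≤n
k≤n⇒nCk>0 {suc k} {suc n} (s≤s k≤n) =
  subst (0 <_) (pascal n k) (≤-trans (k≤n⇒nCk>0 k≤n) (m≤m+n (n C k) (n C suc k)))

nCk≤[d+n]C[d+k] : ∀ d n k → n C k ≤ (d + n) C (d + k)
nCk≤[d+n]C[d+k] zero    n k = ≤-refl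
nCk≤[d+n]C[d+k] (suc d) n k =
  ≤-trans (nCk≤[d+n]C[d+k] d n k) (subst ((d + n) C (d + k) ≤_) (pascal (d + n) (d + k)) (m≤m+n _ _))

[k+1]*[n+1]C[k+1]≡[n+1]*nCk : ∀ n k → suc k * (suc n C suc k) ≡ suc n * (n C k)
[k+1]*[n+1]C[k+1]≡[n+1]*nCk zero    zero    = refl
[k+1]*[n+1]C[k+1]≡[n+1]*nCk zero    (suc k) = *-zeroʳ (2 + k)
[k+1]*[n+1]C[k+1]≡[n+1]*nCk (suc n) zero    =
  trans (+-identityʳ _) (trans (nC1≡n (2 + n)) (sym (*-identityʳ (2 + n))))
[k+1]*[n+1]C[k+1]≡[n+1]*nCk (suc n) (suc k) = begin
  (2 + k) * ((2 + n) C (2 + k))                      ≡⟨ cong ((2 + k) *_) (pascal (1 + n) (1 + k)) ⟨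
  (2 + k) * (P + Q)                                  ≡⟨ *-distribˡ-+ (2 + k) P Q ⟩
  (P + (1 + k) * P) + (2 + k) * Q                    ≡⟨ +-assoc P _ _ ⟩
  P + ((1 + k) * P + (2 + k) * Q)                    ≡⟨ cong (P +_) (cong₂ _+_ ([k+1]*[n+1]C[k+1]≡[n+1]*nCk n k)
                                                                           ([k+1]*[n+1]C[k+1]≡[n+1]*nCk n (1 + k))) ⟩
  P + ((1 + n) * (n C k) + (1 + n) * (n C (1 + k)))  ≡⟨ cong (P +_) (*-distribˡ-+ (1 + n) (n C k) (n C (1 + k))) ⟨
  P + (1 + n) * (n C k + n C (1 + k))                ≡⟨ cong (λ m → P + (1 + n) * m) (pascal n k) ⟩
  (2 + n) * P                                        ∎
  where
  open ≡-Reasoning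
  P = (1 + n) C (1 + k)
  Q = (1 + n) C (2 + k)

-- Cross-multiplied form of  1 < c C(N,J+1)/C(N+2,J+2) + C(N,J)/C(N+1,J+1).
binomial-ratio-sum>1 : ∀ c N J → J < N → 2 + N < c * (2 + J) →
  ((2 + N) C (2 + J)) * ((1 + N) C (1 + J))
    < c * (N C (1 + J)) * ((1 + N) C (1 + J)) + (N C J) * ((2 + N) C (2 + J))
binomial-ratio-sum>1 c N J J<N 2+N<c[2+J] = *-cancelˡ-< (2 + J) _ _ (begin-strict
  (2 + J) * (D₁ * D₂)                      ≡⟨ *-assoc (2 + J) D₁ D₂ ⟨
  (2 + J) * D₁ * D₂                        ≡⟨ cong (_* D₂) absorption ⟩
  (2 + N) * D₂ * D₂                        ≡⟨ cong (λ m → (2 + N) * m * D₂) (pascal N J) ⟨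
  (2 + N) * (P + Q) * D₂                   ≡⟨ cong (_* D₂) (*-distribˡ-+ (2 + N) P Q) ⟩
  ((2 + N) * P + (2 + N) * Q) * D₂         <⟨ *-monoˡ-< D₂ {{>-nonZero D₂>0}} (+-monoʳ-< ((2 + N) * P) NQ<cJQ) ⟩
  ((2 + N) * P + c * (2 + J) * Q) * D₂     ≡⟨ regroup (2 + N) P c (2 + J) Q D₂ ⟩
  (2 + J) * (c * Q * D₂) + P * ((2 + N) * D₂)
                                           ≡⟨ cong (λ m → (2 + J) * (c * Q * D₂) + P * m) absorption ⟨
  (2 + J) * (c * Q * D₂) + P * ((2 + J) * D₁)
                                           ≡⟨ distribute (2 + J) c Q D₂ P D₁ ⟩
  (2 + J) * (c * Q * D₂ + P * D₁)          ∎)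
  where
  open ≤-Reasoning
  D₁ = (2 + N) C (2 + J)
  D₂ = (1 + N) C (1 + J)
  P = N C J
  Q = N C (1 + J)
  absorption : (2 + J) * D₁ ≡ (2 + N) * D₂
  absorption = [k+1]*[n+1]C[k+1]≡[n+1]*nCk (1 + N) (1 + J)
  D₂>0 : 0 < D₂
  D₂>0 = k≤n⇒nCk>0 (s≤s (<⇒≤ J<N))
  NQ<cJQ : (2 + N) * Q < c * (2 + J) * Q
  NQ<cJQ = *-monoˡ-< Q {{>-nonZero (k≤n⇒nCk>0 J<N)}} 2+N<c[2+J]
  regroup : ∀ m p c j q d → (m * p + c * j * q) * d ≡ j * (c * q * d) + p * (m * d)
  regroup = solve-∀
  distribute : ∀ j c q d p e → j * (c * q * d) + p * (j * e) ≡ j * (c * q * d + p * e)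
  distribute = solve-∀

length-cartesianProductWith : ∀ {A B C : Set} (f : A → B → C) xs ys →
  length (cartesianProductWith f xs ys) ≡ length xs * length ys
length-cartesianProductWith f []       ys = refl
length-cartesianProductWith f (x ∷ xs) ys = begin
  length (map (f x) ys ++ cartesianProductWith f xs ys)     ≡⟨ length-++ (map (f x) ys) ⟩
  length (map (f x) ys) + length (cartesianProductWith f xs ys)
                                                            ≡⟨ cong₂ _+_ (length-map (f x) ys)
                                                                 (length-cartesianProductWith f xs ys) ⟩
  length ys + length xs * length ys                         ∎
  where open ≡-Reasoning

subsetsOfSize : ∀ n → ℕ → List (Subset n)
subsetsOfSize n       zero    = ∅ ∷ []
subsetsOfSize zero    (suc r) = []
subsetsOfSize (suc n) (suc r) = map (inside ∷_) (subsetsOfSize n r) ++ map (outside ∷_) (subsetsOfSize n (suc r))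

length-subsetsOfSize : ∀ n r → length (subsetsOfSize n r) ≡ n C r
length-subsetsOfSize n       zero    = refl
length-subsetsOfSize zero    (suc r) = refl
length-subsetsOfSize (suc n) (suc r) = begin
  length (map (inside ∷_) S₀ ++ map (outside ∷_) S₁)           ≡⟨ length-++ (map (inside ∷_) S₀) ⟩
  length (map (inside ∷_) S₀) + length (map (outside ∷_) S₁)   ≡⟨ cong₂ _+_ (length-map (inside ∷_) S₀)
                                                                               (length-map (outside ∷_) S₁) ⟩
  length S₀ + length S₁                                         ≡⟨ cong₂ _+_ (length-subsetsOfSize n r)
                                                                               (length-subsetsOfSize n (suc r)) ⟩
  n C r + n C suc r                                             ≡⟨ pascal n r ⟩
  suc n C suc r                                                 ∎
  where
  open ≡-Reasoning
  S₀ = subsetsOfSize n r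
  S₁ = subsetsOfSize n (suc r)

subsetsOfSize-size : ∀ n r → All (λ p → ∣ p ∣ ≡ r) (subsetsOfSize n r)
subsetsOfSize-size n       zero    = ∣⊥∣≡0 n ∷ []
subsetsOfSize-size zero    (suc r) = []
subsetsOfSize-size (suc n) (suc r) = All.++⁺
  (All.map⁺ (All.map (cong suc) (subsetsOfSize-size n r)))
  (All.map⁺ (subsetsOfSize-size n (suc r)))

subsetsOfSize-unique : ∀ n r → Unique (subsetsOfSize n r)
subsetsOfSize-unique n       zero    = [] ∷ []
subsetsOfSize-unique zero    (suc r) = []
subsetsOfSize-unique (suc n) (suc r) = Unique.++⁺
  (Unique.map⁺ ∷-injectiveʳ (subsetsOfSize-unique n r))
  (Unique.map⁺ ∷-injectiveʳ (subsetsOfSize-unique n (suc r)))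
  different-heads
  where
  different-heads : Disjoint (map (inside ∷_) (subsetsOfSize n r)) (map (outside ∷_) (subsetsOfSize n (suc r)))
  different-heads (v∈ins , v∈outs) with ∈-map⁻ (inside ∷_) v∈ins | ∈-map⁻ (outside ∷_) v∈outs
  ... | _ , _ , refl | _ , _ , eq with () ← ∷-injectiveˡ eq

∣p⧺q∣≡∣p∣+∣q∣ : (p : Subset a) (q : Subset b) → ∣ p ⧺ q ∣ ≡ ∣ p ∣ + ∣ q ∣
∣p⧺q∣≡∣p∣+∣q∣ ⟨⟩            q = refl
∣p⧺q∣≡∣p∣+∣q∣ (inside ∷ p)  q = cong suc (∣p⧺q∣≡∣p∣+∣q∣ p q)
∣p⧺q∣≡∣p∣+∣q∣ (outside ∷ p) q = ∣p⧺q∣≡∣p∣+∣q∣ p q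

∣p∣+∣q∣≤∣p∩q∣+n : (p q : Subset n) → ∣ p ∣ + ∣ q ∣ ≤ ∣ p ∩ q ∣ + n
∣p∣+∣q∣≤∣p∩q∣+n ⟨⟩            ⟨⟩            = z≤n
∣p∣+∣q∣≤∣p∩q∣+n (inside ∷ p)  (inside ∷ q)  =
  subst₂ _≤_ (sym (+-suc (suc ∣ p ∣) ∣ q ∣)) (sym (+-suc (suc ∣ p ∩ q ∣) _)) (s≤s (s≤s (∣p∣+∣q∣≤∣p∩q∣+n p q)))
∣p∣+∣q∣≤∣p∩q∣+n (inside ∷ p)  (outside ∷ q) =
  subst (suc (∣ p ∣ + ∣ q ∣) ≤_) (sym (+-suc ∣ p ∩ q ∣ _)) (s≤s (∣p∣+∣q∣≤∣p∩q∣+n p q))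
∣p∣+∣q∣≤∣p∩q∣+n (outside ∷ p) (inside ∷ q)  =
  subst₂ _≤_ (sym (+-suc ∣ p ∣ ∣ q ∣)) (sym (+-suc ∣ p ∩ q ∣ _)) (s≤s (∣p∣+∣q∣≤∣p∩q∣+n p q))
∣p∣+∣q∣≤∣p∩q∣+n (outside ∷ p) (outside ∷ q) =
  ≤-trans (∣p∣+∣q∣≤∣p∩q∣+n p q) (+-monoʳ-≤ ∣ p ∩ q ∣ (n≤1+n _))

∣p∩q∣≤∣[p⧺s]∩[q⧺t]∣ : (p q : Subset a) (s t : Subset b) → ∣ p ∩ q ∣ ≤ ∣ (p ⧺ s) ∩ (q ⧺ t) ∣
∣p∩q∣≤∣[p⧺s]∩[q⧺t]∣ p q s t = begin
  ∣ p ∩ q ∣                       ≤⟨ m≤m+n ∣ p ∩ q ∣ ∣ s ∩ t ∣ ⟩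
  ∣ p ∩ q ∣ + ∣ s ∩ t ∣            ≡⟨ ∣p⧺q∣≡∣p∣+∣q∣ (p ∩ q) (s ∩ t) ⟨
  ∣ (p ∩ q) ⧺ (s ∩ t) ∣            ≡⟨ cong ∣_∣ (zipWith-++ _ p s q t) ⟨
  ∣ (p ⧺ s) ∩ (q ⧺ t) ∣            ∎
  where open ≤-Reasoning

-- The sets A ⊆ [a + b] with |A ∩ [a]| = r and |A ∖ [a]| = s; opaque so that a, b, r and s
-- can be inferred from blocks a b r s.
opaque
  blocks : ∀ a b → ℕ → ℕ → List (Subset (a + b))
  blocks a b r s = cartesianProductWith _⧺_ (subsetsOfSize a r) (subsetsOfSize b s)

  ∈-blocks⁻ : ∀ {v} → v ∈ blocks a b r s → ∃₂ λ (p : Subset a) (q : Subset b) → ∣ p ∣ ≡ r × ∣ q ∣ ≡ s × v ≡ p ⧺ q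
  ∈-blocks⁻ {a} {b} {r} {s} v∈
    with p , q , p∈ , q∈ , v≡ ← ∈-cartesianProductWith⁻ _⧺_ (subsetsOfSize a r) (subsetsOfSize b s) v∈ =
    p , q , All.lookup (subsetsOfSize-size a r) p∈ , All.lookup (subsetsOfSize-size b s) q∈ , v≡

  length-blocks : length (blocks a b r s) ≡ (a C r) * (b C s)
  length-blocks {a} {b} {r} {s} =
    trans (length-cartesianProductWith _⧺_ (subsetsOfSize a r) (subsetsOfSize b s))
          (cong₂ _*_ (length-subsetsOfSize a r) (length-subsetsOfSize b s))

  blocks-unique : Unique (blocks a b r s)
  blocks-unique {a} {b} {r} {s} = Unique.cartesianProductWith⁺ _⧺_ (λ {w} {x} → ++-injective w x)
    (subsetsOfSize-unique a r) (subsetsOfSize-unique b s)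

module _ {a b r s : ℕ} where

  blocks-size : All (λ v → ∣ v ∣ ≡ r + s) (blocks a b r s)
  blocks-size = All.tabulate λ v∈ → case ∈-blocks⁻ v∈ of λ where
    (p , q , ∣p∣≡r , ∣q∣≡s , refl) → trans (∣p⧺q∣≡∣p∣+∣q∣ p q) (cong₂ _+_ ∣p∣≡r ∣q∣≡s)

  blocks-disjoint : ∀ {r′ s′} → r ≢ r′ → Disjoint (blocks a b r s) (blocks a b r′ s′)
  blocks-disjoint {r′} {s′} r≢r′ (v∈ , v∈′) with ∈-blocks⁻ v∈ | ∈-blocks⁻ v∈′
  ... | p , _ , ∣p∣≡r , _ , refl | p′ , _ , ∣p′∣≡r′ , _ , eq =
    r≢r′ (trans (sym ∣p∣≡r) (trans (cong ∣_∣ (++-injectiveˡ p p′ eq)) ∣p′∣≡r′))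

  blocks-∩ : ∀ {r′ s′} {A B : Subset (a + b)} → A ∈ blocks a b r s → B ∈ blocks a b r′ s′ → r + r′ ≤ ∣ A ∩ B ∣ + a
  blocks-∩ {r′} {s′} {A} {B} A∈ B∈ with ∈-blocks⁻ A∈ | ∈-blocks⁻ B∈
  ... | p , q , ∣p∣≡r , _ , refl | p′ , q′ , ∣p′∣≡r′ , _ , refl =
    subst (_≤ ∣ A ∩ B ∣ + a) (cong₂ _+_ ∣p∣≡r ∣p′∣≡r′)
      (≤-trans (∣p∣+∣q∣≤∣p∩q∣+n p p′) (+-monoˡ-≤ a (∣p∩q∣≤∣[p⧺s]∩[q⧺t]∣ p p′ q q′)))

minWith-≤ : ∀ d {xs x} → x ∈ xs → minWith d xs ≤ x
minWith-≤ d {x ∷ []}     (here refl) = ≤-refl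
minWith-≤ d {x ∷ _ ∷ _}  (here refl) = m⊓n≤m x _
minWith-≤ d {x ∷ y ∷ xs} (there x∈) = ≤-trans (m⊓n≤n x _) (minWith-≤ d x∈)

≤-minWith : ∀ d {m xs x} → x ∈ xs → All (m ≤_) xs → m ≤ minWith d xs
≤-minWith d {xs = _ ∷ []}    _ (m≤x ∷ [])  = m≤x
≤-minWith d {xs = _ ∷ y ∷ _} _ (m≤x ∷ m≤xs) = ⊓-glb m≤x (≤-minWith d (here {x = y} refl) m≤xs)

module _ {F : List (Subset n)} {A : Subset n} (A∈F : A ∈ F) where

  iF≤∣A∣ : iF F A ≤ ∣ A ∣
  iF≤∣A∣ = subst (iF F A ≤_) (cong ∣_∣ (∩-idem A)) (minWith-≤ 0 (∈-map⁺ (λ B → ∣ A ∩ B ∣) A∈F))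

  ≤-iF : ∀ {m} → (∀ {B} → B ∈ F → m ≤ ∣ A ∩ B ∣) → m ≤ iF F A
  ≤-iF m≤∣A∩B∣ = ≤-minWith 0 (∈-map⁺ (λ B → ∣ A ∩ B ∣) A∈F) (All.map⁺ (All.tabulate m≤∣A∩B∣))

recip-suc : ∀ d → recip (suc d) ≡ mkℚ (ℤ.+ 1) d (1-coprimeTo (suc d))
recip-suc d = ℚ.normalize-coprime (1-coprimeTo (suc d))

recip-antitone : 0 < a → a ≤ b → recip b ≤ℚ recip a
recip-antitone {suc a} {suc b} _ a≤b = subst₂ _≤ℚ_ (sym (recip-suc b)) (sym (recip-suc a))
  (ℚ.*≤* (subst₂ ℤ._≤_ (sym (ℤ.*-identityˡ _)) (sym (ℤ.*-identityˡ _)) (+≤+ a≤b)))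

toℚᵘ-·-recip : ∀ c d → toℚᵘ (c · recip (suc d)) ℚᵘ.≃ ℚᵘ.mkℚᵘ (ℤ.+ c) d
toℚᵘ-·-recip zero    d = ℚᵘ.*≡* refl
toℚᵘ-·-recip (suc c) d = begin
  toℚᵘ (recip (suc d) +ℚ c · recip (suc d))           ≈⟨ ℚ.toℚᵘ-homo-+ (recip (suc d)) _ ⟩
  toℚᵘ (recip (suc d)) ℚᵘ.+ toℚᵘ (c · recip (suc d))  ≈⟨ ℚᵘ.+-cong (ℚ.toℚᵘ-cong (recip-suc d)) (toℚᵘ-·-recip c d) ⟩
  ℚᵘ.mkℚᵘ (ℤ.+ 1) d ℚᵘ.+ ℚᵘ.mkℚᵘ (ℤ.+ c) d            ≈⟨ ℚᵘ.*≡* (trans (same-denominator (ℤ.+ c) (ℤ.+ suc d))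
                                                           (cong (ℤ.+ suc c ℤ.*_) (sym (ℤ.pos-* (suc d) (suc d))))) ⟩
  ℚᵘ.mkℚᵘ (ℤ.+ suc c) d                               ∎
  where
  open ℚᵘ.≃-Reasoning
  same-denominator : ∀ c e → (ℤ.+ 1 ℤ.* e ℤ.+ c ℤ.* e) ℤ.* e ≡ (ℤ.+ 1 ℤ.+ c) ℤ.* (e ℤ.* e)
  same-denominator = ℤ.solve-∀

1<·recip+·recip : ∀ c₁ c₂ {D₁ D₂} → 0 < D₁ → 0 < D₂ → D₁ * D₂ < c₁ * D₂ + c₂ * D₁ →
                  1ℚ <ℚ c₁ · recip D₁ +ℚ c₂ · recip D₂
1<·recip+·recip c₁ c₂ {suc d₁} {suc d₂} _ _ D₁D₂<c₁D₂+c₂D₁ =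
  ℚ.toℚᵘ-cancel-< (ℚᵘ.<-respʳ-≃ (ℚᵘ.≃-sym sum≃) (ℚᵘ.*<*
    (subst₂ ℤ._<_ (sym (ℤ.*-identityˡ _)) (sym (ℤ.*-identityʳ _))
      (subst (ℤ.+ (suc d₁ * suc d₂) ℤ.<_) numerator (+<+ D₁D₂<c₁D₂+c₂D₁)))))
  where
  sum≃ : toℚᵘ (c₁ · recip (suc d₁) +ℚ c₂ · recip (suc d₂)) ℚᵘ.≃ ℚᵘ.mkℚᵘ (ℤ.+ c₁) d₁ ℚᵘ.+ ℚᵘ.mkℚᵘ (ℤ.+ c₂) d₂
  sum≃ = ℚᵘ.≃-trans (ℚ.toℚᵘ-homo-+ (c₁ · recip (suc d₁)) (c₂ · recip (suc d₂)))
                    (ℚᵘ.+-cong (toℚᵘ-·-recip c₁ d₁) (toℚᵘ-·-recip c₂ d₂))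
  numerator : ℤ.+ (c₁ * suc d₂ + c₂ * suc d₁) ≡ ℤ.+ c₁ ℤ.* ℤ.+ suc d₂ ℤ.+ ℤ.+ c₂ ℤ.* ℤ.+ suc d₁
  numerator = trans (ℤ.pos-+ (c₁ * suc d₂) _) (cong₂ ℤ._+_ (ℤ.pos-* c₁ (suc d₂)) (ℤ.pos-* c₂ (suc d₁)))

·-≤-foldr-+ : ∀ {A : Set} {f : A → ℚ} {q} z xs → All (λ x → q ≤ℚ f x) xs →
              length xs · q +ℚ z ≤ℚ foldr _+ℚ_ z (map f xs)
·-≤-foldr-+     z []       []            = ℚ.≤-reflexive (ℚ.+-identityˡ z)
·-≤-foldr-+ {q = q} z (x ∷ xs) (q≤fx ∷ q≤fxs) =
  ℚ.≤-trans (ℚ.≤-reflexive (ℚ.+-assoc q (length xs · q) z)) (ℚ.+-mono-≤ q≤fx (·-≤-foldr-+ z xs q≤fxs))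

recip-C-antitone : ∀ {l i} → l ≤ i → i ≤ k → k ≤ n → recip ((n ∸ l) C (k ∸ l)) ≤ℚ recip ((n ∸ i) C (k ∸ i))
recip-C-antitone {k} {n} {l} {i} l≤i i≤k k≤n = recip-antitone (k≤n⇒nCk>0 (∸-monoˡ-≤ i k≤n))
  (subst ((n ∸ i) C (k ∸ i) ≤_) (sym (cong₂ _C_ (split (≤-trans i≤k k≤n)) (split i≤k)))
    (nCk≤[d+n]C[d+k] (i ∸ l) (n ∸ i) (k ∸ i)))
  where
  split : ∀ {m} → i ≤ m → m ∸ l ≡ (i ∸ l) + (m ∸ i)
  split {m} i≤m = trans (cong (_∸ l) (sym (m+[n∸m]≡n i≤m))) (+-∸-comm (m ∸ i) l≤i)

Φ-++-≥ : ∀ {l₁ l₂} (G H : List (Subset n)) → k ≤ n → All (λ A → ∣ A ∣ ≡ k) (G ++ H) →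
         (∀ {A B} → A ∈ G → B ∈ G ++ H → l₁ ≤ ∣ A ∩ B ∣) →
         (∀ {A B} → A ∈ H → B ∈ G ++ H → l₂ ≤ ∣ A ∩ B ∣) →
         length G · recip ((n ∸ l₁) C (k ∸ l₁)) +ℚ length H · recip ((n ∸ l₂) C (k ∸ l₂)) ≤ℚ Φ n k (G ++ H)
Φ-++-≥ {n} {k} {l₁} {l₂} G H k≤n sizes G-meets H-meets = begin
  length G · q₁ +ℚ length H · q₂                    ≡⟨ cong (length G · q₁ +ℚ_) (ℚ.+-identityʳ (length H · q₂)) ⟨
  length G · q₁ +ℚ (length H · q₂ +ℚ 0ℚ)            ≤⟨ ℚ.+-monoʳ-≤ (length G · q₁) (·-≤-foldr-+ 0ℚ H
                                                         (All.tabulate λ A∈H → term-≥ (∈-++⁺ʳ G A∈H) (H-meets A∈H))) ⟩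
  length G · q₁ +ℚ foldr _+ℚ_ 0ℚ (map t H)          ≤⟨ ·-≤-foldr-+ _ G
                                                         (All.tabulate λ A∈G → term-≥ (∈-++⁺ˡ A∈G) (G-meets A∈G)) ⟩
  foldr _+ℚ_ (foldr _+ℚ_ 0ℚ (map t H)) (map t G)    ≡⟨ foldr-++ _+ℚ_ 0ℚ (map t G) (map t H) ⟨
  foldr _+ℚ_ 0ℚ (map t G ++ map t H)                ≡⟨ cong (foldr _+ℚ_ 0ℚ) (map-++ t G H) ⟨
  Φ n k (G ++ H)                                    ∎
  where
  open ℚ.≤-Reasoning
  q₁ = recip ((n ∸ l₁) C (k ∸ l₁))
  q₂ = recip ((n ∸ l₂) C (k ∸ l₂))
  t : Subset n → ℚ
  t A = recip ((n ∸ iF (G ++ H) A) C (k ∸ iF (G ++ H) A))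
  term-≥ : ∀ {l A} → A ∈ G ++ H → (∀ {B} → B ∈ G ++ H → l ≤ ∣ A ∩ B ∣) → recip ((n ∸ l) C (k ∸ l)) ≤ℚ t A
  term-≥ A∈F l≤∣A∩B∣ =
    recip-C-antitone (≤-iF A∈F l≤∣A∩B∣) (≤-trans (iF≤∣A∣ A∈F) (≤-reflexive (All.lookup sizes A∈F))) k≤n

FamilyWithΦ>1 : (n k : ℕ) → Set
FamilyWithΦ>1 n k = Σ (List (Subset n)) (λ F → IsFamily n k F × 1ℚ <ℚ Φ n k F)

-- Ground set [2 + y] ⊎ [N] and k = 2 + y + J.
module BlockConstruction (y J N : ℕ) where

  sparse full family : List (Subset (2 + y + N))
  sparse = blocks (2 + y) N (1 + y) (1 + J)
  full   = blocks (2 + y) N (2 + y) J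
  family = sparse ++ full

  family-isFamily : IsFamily (2 + y + N) (2 + y + J) family
  family-isFamily = Unique.++⁺ blocks-unique blocks-unique (blocks-disjoint (<⇒≢ (n<1+n (1 + y))))
                  , All.++⁺ (All.map (λ ∣A∣≡ → trans ∣A∣≡ (+-suc (1 + y) J)) blocks-size) blocks-size

  ∩-family : ∀ {r s A B} → A ∈ blocks (2 + y) N r s → B ∈ family → r + (1 + y) ≤ ∣ A ∩ B ∣ + (2 + y)
  ∩-family {r} A∈ B∈ = [ blocks-∩ A∈
                       , (λ B∈full → ≤-trans (+-monoʳ-≤ r (n≤1+n (1 + y))) (blocks-∩ A∈ B∈full)) ]′
                       (∈-++⁻ sparse B∈)

  sparse-meets : ∀ {A B} → A ∈ sparse → B ∈ family → y ≤ ∣ A ∩ B ∣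
  sparse-meets {A} {B} A∈ B∈ = +-cancelʳ-≤ (2 + y) y ∣ A ∩ B ∣
    (subst (_≤ ∣ A ∩ B ∣ + (2 + y)) (sym (+-suc y (1 + y))) (∩-family A∈ B∈))

  full-meets : ∀ {A B} → A ∈ full → B ∈ family → 1 + y ≤ ∣ A ∩ B ∣
  full-meets {A} {B} A∈ B∈ = +-cancelʳ-≤ (2 + y) (1 + y) ∣ A ∩ B ∣
    (subst (_≤ ∣ A ∩ B ∣ + (2 + y)) (+-comm (2 + y) (1 + y)) (∩-family A∈ B∈))

  length-sparse : length sparse ≡ (2 + y) * (N C (1 + J))
  length-sparse = trans length-blocks (cong (_* (N C (1 + J))) (begin
    (2 + y) C (1 + y)               ≡⟨ nCk≡nC[n∸k] (n≤1+n (1 + y)) ⟩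
    (2 + y) C ((2 + y) ∸ (1 + y))   ≡⟨ cong ((2 + y) C_) (m+n∸n≡m 1 (1 + y)) ⟩
    (2 + y) C 1                     ≡⟨ nC1≡n (2 + y) ⟩
    2 + y                           ∎))
    where open ≡-Reasoning

  length-full : length full ≡ N C J
  length-full = trans length-blocks (trans (cong (_* (N C J)) (nCn≡1 (2 + y))) (*-identityˡ (N C J)))

  Φ-family>1 : J < N → 2 + N < (2 + y) * (2 + J) → 1ℚ <ℚ Φ (2 + y + N) (2 + y + J) family
  Φ-family>1 J<N 2+N<[2+y][2+J] = begin-strict
    1ℚ                                                  <⟨ 1<·recip+·recip ((2 + y) * Q) P D₁>0 D₂>0
                                                             (binomial-ratio-sum>1 (2 + y) N J J<N 2+N<[2+y][2+J]) ⟩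
    ((2 + y) * Q) · recip D₁ +ℚ P · recip D₂            ≡⟨ cong₂ _+ℚ_ (cong₂ (λ c D → c · recip D) length-sparse D₁≡)
                                                                      (cong₂ (λ c D → c · recip D) length-full D₂≡) ⟨
    length sparse · recip ((2 + y + N ∸ y) C (2 + y + J ∸ y))
      +ℚ length full · recip ((2 + y + N ∸ (1 + y)) C (2 + y + J ∸ (1 + y)))
                                                        ≤⟨ Φ-++-≥ sparse full (+-monoʳ-≤ (2 + y) (<⇒≤ J<N))
                                                             (proj₂ family-isFamily) sparse-meets full-meets ⟩
    Φ (2 + y + N) (2 + y + J) family                    ∎
    where
    open ℚ.≤-Reasoning
    P = N C J
    Q = N C (1 + J)
    D₁ = (2 + N) C (2 + J)
    D₂ = (1 + N) C (1 + J)
    D₁>0 : 0 < D₁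
    D₁>0 = k≤n⇒nCk>0 (s≤s (s≤s (<⇒≤ J<N)))
    D₂>0 : 0 < D₂
    D₂>0 = k≤n⇒nCk>0 (s≤s (<⇒≤ J<N))
    D₁≡ : (2 + y + N ∸ y) C (2 + y + J ∸ y) ≡ D₁
    D₁≡ = cong₂ _C_ (m+n+o∸n≡m+o 2 y N) (m+n+o∸n≡m+o 2 y J)
    D₂≡ : (2 + y + N ∸ (1 + y)) C (2 + y + J ∸ (1 + y)) ≡ D₂
    D₂≡ = cong₂ _C_ (m+n+o∸n≡m+o 1 (1 + y) N) (m+n+o∸n≡m+o 1 (1 + y) J)

  family-witness : J < N → 2 + N < (2 + y) * (2 + J) → FamilyWithΦ>1 (2 + y + N) (2 + y + J)
  family-witness J<N 2+N<[2+y][2+J] = family , family-isFamily , Φ-family>1 J<N 2+N<[2+y][2+J]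

corollary6p2 : (k n : ℕ) → 3 ≤ k → k < n → n < k + ⌈ k /2⌉ * (⌊ k /2⌋ + 1) →
    Σ (List (Subset n)) (λ F → IsFamily n k F × 1ℚ <ℚ Φ n k F)
corollary6p2 k@(suc (suc (suc k′))) n (s≤s (s≤s (s≤s z≤n))) k<n n<bound =
  subst₂ FamilyWithΦ>1 n≡ k≡ (BlockConstruction.family-witness y J N J<N 2+N<[2+y][2+J])
  where
  -- ⌈ k /2⌉ = 1 + y and ⌊ k /2⌋ = 1 + J hold by computation.
  y = suc ⌊ k′ /2⌋
  J = ⌈ k′ /2⌉
  N = n ∸ (2 + y)
  k≡ : 2 + y + J ≡ k
  k≡ = cong (3 +_) (⌊n/2⌋+⌈n/2⌉≡n k′)
  n≡ : 2 + y + N ≡ n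
  n≡ = m+[n∸m]≡n (≤-trans (m≤m+n (2 + y) J) (≤-trans (≤-reflexive k≡) (<⇒≤ k<n)))
  J<N : J < N
  J<N = +-cancelˡ-< (2 + y) J N (subst₂ _<_ (sym k≡) (sym n≡) k<n)
  2+N<[2+y][2+J] : 2 + N < (2 + y) * (2 + J)
  2+N<[2+y][2+J] = s≤s (s≤s (+-cancelˡ-< (2 + y) N _ (begin-strict
    2 + y + N                          ≡⟨ n≡ ⟩
    n                                  <⟨ n<bound ⟩
    k + (1 + y) * (1 + J + 1)          ≡⟨ cong₂ (λ m j → m + (1 + y) * j) (sym k≡) (+-comm (1 + J) 1) ⟩
    2 + y + J + (1 + y) * (2 + J)      ≡⟨ +-assoc (2 + y) J _ ⟩
    2 + y + (J + (1 + y) * (2 + J))    ∎)))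
    where open ≤-Reasoning
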